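{- Let $A$ and $B$ be stable matching instances on the same workers $\mathcal{W}$ and firms $\mathcal{F}$ in which every worker has the same preference list in $A$ as in $B$, and let $X$ be their compound instance. Then a perfect matching $M$ is strongly stable under $X$ if and only if it is stable under both $A$ and $B$; that is, $\mathcal{M}_X=\mathcal{M}_A\cap\mathcal{M}_B$.
   Context: In a stable matching instance each agent strictly totally orders the agents of the other side; a perfect matching $M$ is stable under instance $I$ if there is no pair $(w,f)\notin M$ with $w$ preferring $f$ to $M(w)$ and $f$ preferring $w$ to $M(f)$ under $I$; $\mathcal{M}_I$ denotes the set of stable matchings of $I$. The compound instance $X$ of $A$ and $B$: each worker has its (common) list from $A$ and $B$; each firm $f$ has the partial order $w_i >^X_f w_j$ iff $w_i >^A_f w_j$ and $w_i >^B_f w_j$; if neither $w_i>^X_f w_j$ nor $w_j>^X_f w_i$, $f$ is indifferent, written $w_i\sim^X_f w_j$. For a perfect matching $M$, a pair $(w,f)\notin M$ is strongly blocking under $X$ if $w$ prefers $f$ to $M(w)$ and either $w>^X_f M(f)$ or $w\sim^X_f M(f)$. $M$ is strongly stable under $X$ if it has no strongly blocking pair; $\mathcal{M}_X$ is the set of such matchings. -}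

module Defs where

open import Data.Nat using (ℕ; _<_)
open import Data.Fin using (Fin)
open import Data.Product using (_×_)
open import Data.Sum using (_⊎_)
open import Relation.Nullary using (¬_)
open import Relation.Binary.PropositionalEquality using (_≡_; _≢_)
open import Function.Definitions using (Injective)
open import Function.Bundles using (_↔_; Inverse)

-- A stable matching instance with workers Fin m and firms Fin k.
-- Each agent's strict total order is given by an injective rank function:
-- a smaller rank means more preferred.
record Instance (m k : ℕ) : Set where
  field
    wrank     : Fin m → Fin k → ℕ
    wrank-inj : ∀ w → Injective _≡_ _≡_ (wrank w)
    frank     : Fin k → Fin m → ℕ
    frank-inj : ∀ f → Injective _≡_ _≡_ (frank f)
open Instance public

WPrefers : ∀ {m k} → Instance m k → Fin m → Fin k → Fin k → Set
WPrefers I w f f' = wrank I w f < wrank I w f'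

FPrefers : ∀ {m k} → Instance m k → Fin k → Fin m → Fin m → Set
FPrefers I f w w' = frank I f w < frank I f w'

Matching : ℕ → ℕ → Set
Matching m k = Fin m ↔ Fin k

module _ {m k : ℕ} (M : Matching m k) where
  open Inverse M
  mW : Fin m → Fin k
  mW = to
  mF : Fin k → Fin m
  mF = from

NotIn : ∀ {m k} → Matching m k → Fin m → Fin k → Set
NotIn M w f = mW M w ≢ f

Blocking : ∀ {m k} → Instance m k → Matching m k → Fin m → Fin k → Set
Blocking I M w f =
  NotIn M w f × WPrefers I w f (mW M w) × FPrefers I f w (mF M f)

Stable : ∀ {m k} → Instance m k → Matching m k → Set
Stable I M = ∀ w f → ¬ Blocking I M w f

-- Compound instance X of A and B (workers' lists are those of A, which
-- coincide with those of B under the standing hypothesis).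
-- Firm partial order: w >X_f w' iff w >A_f w' and w >B_f w'.
FPrefersX : ∀ {m k} → Instance m k → Instance m k → Fin k → Fin m → Fin m → Set
FPrefersX A B f w w' = FPrefers A f w w' × FPrefers B f w w'

IndiffX : ∀ {m k} → Instance m k → Instance m k → Fin k → Fin m → Fin m → Set
IndiffX A B f w w' = ¬ FPrefersX A B f w w' × ¬ FPrefersX A B f w' w

StronglyBlocking : ∀ {m k} → Instance m k → Instance m k → Matching m k →
                   Fin m → Fin k → Set
StronglyBlocking A B M w f =
  NotIn M w f × WPrefers A w f (mW M w) ×
  (FPrefersX A B f w (mF M f) ⊎ IndiffX A B f w (mF M f))

StronglyStable : ∀ {m k} → Instance m k → Instance m k → Matching m k → Set
StronglyStable A B M = ∀ w f → ¬ StronglyBlocking A B M w f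

-- For w ≠ M(f), "w >X M(f) or w ~X M(f)" says exactly that M(f) is not above w in both
-- A and B, i.e. (ranks being injective) that f prefers w to M(f) in A or in B. As the
-- workers' lists agree, a strongly blocking pair under X is thus precisely a pair
-- blocking M under A or under B.
module Submission where

open import Defs
open import Data.Nat using (_<_)
open import Data.Nat.Properties using (<-asym; <-cmp; _<?_)
open import Data.Fin using (Fin)
open import Data.Product using (_×_; _,_)
open import Data.Sum using (_⊎_; inj₁; inj₂; [_,_])
import Data.Sum as Sum
open import Relation.Nullary using (¬_; yes; no; contradiction)
open import Relation.Nullary.Decidable using (Dec; _×-dec_)
open import Relation.Binary using (tri<; tri≈; tri>)
open import Relation.Binary.PropositionalEquality using (_≡_; _≢_; sym; trans; cong; subst₂)
open import Function.Base using (_∘_)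
open import Function.Bundles using (_⇔_; mk⇔; Inverse; Equivalence)
import Function.Properties.Equivalence as ⇔

module _ {m k} (I : Instance m k) {f : Fin k} {w w' : Fin m} where

  FPrefers-connex : w ≢ w' → FPrefers I f w w' ⊎ FPrefers I f w' w
  FPrefers-connex w≢w' with <-cmp (frank I f w) (frank I f w')
  ... | tri< w<w' _ _ = inj₁ w<w'
  ... | tri≈ _ w≈w' _ = contradiction (frank-inj I f w≈w') w≢w'
  ... | tri> _ _ w'<w = inj₂ w'<w

  FPrefers-asym : FPrefers I f w w' → ¬ FPrefers I f w' w
  FPrefers-asym = <-asym

WPrefers-transport : ∀ {m k} (A B : Instance m k) {w} →
                     (∀ f → wrank A w f ≡ wrank B w f) →
                     ∀ {f f'} → WPrefers A w f f' → WPrefers B w f f'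
WPrefers-transport _ _ eq {f} {f'} = subst₂ _<_ (eq f) (eq f')

NotIn⇒≢partner : ∀ {m k} (M : Matching m k) {w f} → NotIn M w f → w ≢ mF M f
NotIn⇒≢partner M {f = f} ni w≡Mf =
  ni (trans (cong (mW M) w≡Mf) (Inverse.strictlyInverseˡ M f))

FPrefersX? : ∀ {m k} (A B : Instance m k) f w w' → Dec (FPrefersX A B f w w')
FPrefersX? A B f w w' = frank A f w <? frank A f w' ×-dec frank B f w <? frank B f w'

module _ {m k} (A B : Instance m k) {f : Fin k} {w w' : Fin m} where

  weaklyPrefersX⇔¬prefersX :
    (FPrefersX A B f w w' ⊎ IndiffX A B f w w') ⇔ (¬ FPrefersX A B f w' w)
  weaklyPrefersX⇔¬prefersX = mk⇔ to from
    where
    to : FPrefersX A B f w w' ⊎ IndiffX A B f w w' → ¬ FPrefersX A B f w' w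
    to (inj₁ (w<A , _)) (w'<A , _) = FPrefers-asym A w<A w'<A
    to (inj₂ (_ , ¬w'>w)) = ¬w'>w
    from : ¬ FPrefersX A B f w' w → FPrefersX A B f w w' ⊎ IndiffX A B f w w'
    from ¬w'>w with FPrefersX? A B f w w'
    ... | yes w>w' = inj₁ w>w'
    ... | no ¬w>w' = inj₂ (¬w>w' , ¬w'>w)

  ¬prefersX⇔prefersA⊎prefersB :
    w ≢ w' → (¬ FPrefersX A B f w' w) ⇔ (FPrefers A f w w' ⊎ FPrefers B f w w')
  ¬prefersX⇔prefersA⊎prefersB w≢w' = mk⇔ to from
    where
    to : ¬ FPrefersX A B f w' w → FPrefers A f w w' ⊎ FPrefers B f w w'
    to ¬w'>w with FPrefers-connex A {f} w≢w' | FPrefers-connex B {f} w≢w'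
    ... | inj₁ w<A  | _         = inj₁ w<A
    ... | inj₂ _    | inj₁ w<B  = inj₂ w<B
    ... | inj₂ w'<A | inj₂ w'<B = contradiction (w'<A , w'<B) ¬w'>w
    from : FPrefers A f w w' ⊎ FPrefers B f w w' → ¬ FPrefersX A B f w' w
    from (inj₁ w<A) (w'<A , _) = FPrefers-asym A w<A w'<A
    from (inj₂ w<B) (_ , w'<B) = FPrefers-asym B w<B w'<B

StronglyBlocking⇔Blocking⊎Blocking :
  ∀ {m k} (A B : Instance m k) → (∀ w f → wrank A w f ≡ wrank B w f) →
  ∀ M w f → StronglyBlocking A B M w f ⇔ (Blocking A M w f ⊎ Blocking B M w f)
StronglyBlocking⇔Blocking⊎Blocking A B eq M w f = mk⇔ to from
  where
  firmSide : NotIn M w f →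
             (FPrefersX A B f w (mF M f) ⊎ IndiffX A B f w (mF M f)) ⇔
             (FPrefers A f w (mF M f) ⊎ FPrefers B f w (mF M f))
  firmSide ni = ⇔.trans
    (weaklyPrefersX⇔¬prefersX A B)
    (¬prefersX⇔prefersA⊎prefersB A B (NotIn⇒≢partner M ni))

  to : StronglyBlocking A B M w f → Blocking A M w f ⊎ Blocking B M w f
  to (ni , wp , weak) =
    Sum.map (λ w<A → ni , wp , w<A)
            (λ w<B → ni , WPrefers-transport A B (eq w) wp , w<B)
            (Equivalence.to (firmSide ni) weak)

  from : Blocking A M w f ⊎ Blocking B M w f → StronglyBlocking A B M w f
  from (inj₁ (ni , wp , w<A)) = ni , wp , Equivalence.from (firmSide ni) (inj₁ w<A)
  from (inj₂ (ni , wp , w<B)) =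
    ni , WPrefers-transport B A (sym ∘ eq w) wp , Equivalence.from (firmSide ni) (inj₂ w<B)

lemma4 : ∀ {m k} (A B : Instance m k) →
         (∀ w f → wrank A w f ≡ wrank B w f) →
         (M : Matching m k) →
         StronglyStable A B M ⇔ (Stable A M × Stable B M)
lemma4 A B eq M = mk⇔ stableBoth stronglyStable
  where
  blocking⇔ : ∀ w f → StronglyBlocking A B M w f ⇔ (Blocking A M w f ⊎ Blocking B M w f)
  blocking⇔ = StronglyBlocking⇔Blocking⊎Blocking A B eq M

  stableBoth : StronglyStable A B M → Stable A M × Stable B M
  stableBoth stable-X = (λ w f → stable-X w f ∘ Equivalence.from (blocking⇔ w f) ∘ inj₁)
                      , (λ w f → stable-X w f ∘ Equivalence.from (blocking⇔ w f) ∘ inj₂)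

  stronglyStable : Stable A M × Stable B M → StronglyStable A B M
  stronglyStable (stable-A , stable-B) w f =
    [ stable-A w f , stable-B w f ] ∘ Equivalence.to (blocking⇔ w f)
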